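{- There are no minimal elements in $(\mathcal{P}_{\aleph_0}(\mathbb{N})/\equiv_{fe},\leq_{fe})$; that is, for every infinite $A\subseteq\mathbb{N}$ there is an infinite $B\subseteq\mathbb{N}$ with $B\leq_{fe}A$ and $A\not\leq_{fe}B$.
   Context: $\mathbb{N}=\{0,1,2,\dots\}$; $\mathcal{P}_{\aleph_0}(\mathbb{N})$ is the set of infinite subsets of $\mathbb{N}$. For $A,B\subseteq\mathbb{N}$, $A\leq_{fe}B$ means that for every finite $F\subseteq A$ there is $k\in\mathbb{N}$ with $F+k\subseteq B$; $A\equiv_{fe}B$ means $A\leq_{fe}B$ and $B\leq_{fe}A$, and $\leq_{fe}$ is induced on equivalence classes. -}

module Defs where

open import Level using (0ℓ)
open import Data.Nat using (ℕ; _+_; _≤_)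
open import Data.Product using (Σ; _×_; ∃)
open import Data.List using (List; map)
open import Data.List.Relation.Unary.All using (All)
open import Relation.Unary using (Pred; _∈_)

Subset : Set₁
Subset = Pred ℕ 0ℓ

Infinite : Subset → Set
Infinite A = ∀ n → ∃ λ m → n ≤ m × m ∈ A

-- Finite subsets F ⊆ A are represented by finite lists of elements of A.
-- F + k = { x + k | x ∈ F }.
shift : ℕ → List ℕ → List ℕ
shift k F = map (λ x → x + k) F

_≤fe_ : Subset → Subset → Set
A ≤fe B = (F : List ℕ) → All (λ x → x ∈ A) F → ∃ λ k → All (λ y → y ∈ B) (shift k F)

-- Pick x < y in A and thin A out to a subset B whose gaps all exceed y.  Then B ⊆ A, so
-- B ≤fe A by the zero shift, while no translate of {x, y} fits into B, so A ≰fe B.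
module Submission where

open import Defs
open import Data.Product using (_×_; ∃; _,_; proj₁; proj₂)
open import Relation.Nullary using (¬_)
open import Data.Nat using (ℕ; zero; suc; _+_; _≤_; _<_; _≤′_; ≤′-reflexive; ≤′-step; z≤n; s≤s)
open import Data.Nat.Properties
open import Data.List using ([]; _∷_)
open import Data.List.Relation.Unary.All as All using (All; []; _∷_)
open import Data.List.Relation.Unary.All.Properties using (map⁺)
open import Relation.Binary.PropositionalEquality using (_≡_; refl; subst; sym)
open import Relation.Unary using (_∈_; _⊆_)

Sparse : ℕ → Subset → Set
Sparse d B = ∀ {m n} → m ∈ B → n ∈ B → m < n → d + m < n

⊆⇒≤fe : {A B : Subset} → A ⊆ B → A ≤fe B
⊆⇒≤fe {B = B} A⊆B F F⊆A =
  0 , map⁺ (All.map (λ x∈A → subst (_∈ B) (sym (+-identityʳ _)) (A⊆B x∈A)) F⊆A)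

sparse⇒≰fe : {A B : Subset} {d x y : ℕ} → Sparse d B →
             x ∈ A → y ∈ A → x < y → y ≤ d + x → ¬ (A ≤fe B)
sparse⇒≰fe {d = d} {x} {y} sparse x∈A y∈A x<y y≤d+x A≤B
  with A≤B (x ∷ y ∷ []) (x∈A ∷ y∈A ∷ [])
... | k , x+k∈B ∷ y+k∈B ∷ [] = <⇒≱ (sparse x+k∈B y+k∈B (+-monoˡ-< k x<y)) (begin
  y + k        ≤⟨ +-monoˡ-≤ k y≤d+x ⟩
  d + x + k    ≡⟨ +-assoc d x k ⟩
  d + (x + k)  ∎)
  where open ≤-Reasoning

module _ {f : ℕ → ℕ} (f-step : ∀ i → f i < f (suc i)) where

  step⇒mono : ∀ {i j} → i ≤ j → f i ≤ f j
  step⇒mono i≤j = go (≤⇒≤′ i≤j)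
    where
    go : ∀ {i j} → i ≤′ j → f i ≤ f j
    go (≤′-reflexive refl) = ≤-refl
    go (≤′-step i≤′j)      = ≤-trans (go i≤′j) (<⇒≤ (f-step _))

  step⇒reflects-< : ∀ {i j} → f i < f j → i < j
  step⇒reflects-< fi<fj = ≰⇒> (λ j≤i → <⇒≱ fi<fj (step⇒mono j≤i))

  step⇒inflationary : ∀ n → n ≤ f n
  step⇒inflationary zero    = z≤n
  step⇒inflationary (suc n) = ≤-trans (s≤s (step⇒inflationary n)) (f-step n)

module SparseSubset {A : Subset} (A-infinite : Infinite A) (d : ℕ) where

  next : ℕ → ℕ
  next n = proj₁ (A-infinite n)

  ≤-next : ∀ n → n ≤ next n
  ≤-next n = proj₁ (proj₂ (A-infinite n))

  next∈A : ∀ n → next n ∈ A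
  next∈A n = proj₂ (proj₂ (A-infinite n))

  b : ℕ → ℕ
  b zero    = next 0
  b (suc i) = next (suc (d + b i))

  b-gap : ∀ i → d + b i < b (suc i)
  b-gap i = ≤-next _

  b-step : ∀ i → b i < b (suc i)
  b-step i = ≤-<-trans (m≤n+m (b i) d) (b-gap i)

  b∈A : ∀ i → b i ∈ A
  b∈A zero    = next∈A _
  b∈A (suc i) = next∈A _

  B : Subset
  B m = ∃ λ i → b i ≡ m

  B⊆A : B ⊆ A
  B⊆A (i , refl) = b∈A i

  B-infinite : Infinite B
  B-infinite n = b n , step⇒inflationary b-step n , n , refl

  B-sparse : Sparse d B
  B-sparse (i , refl) (j , refl) bi<bj =
    <-≤-trans (b-gap i) (step⇒mono b-step (step⇒reflects-< b-step {i} {j} bi<bj))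

corollary11 : (A : Subset) → Infinite A →
    ∃ λ (B : Subset) → Infinite B × B ≤fe A × ¬ (A ≤fe B)
corollary11 A A-infinite with A-infinite 0
... | x , _ , x∈A with A-infinite (suc x)
...   | y , x<y , y∈A =
  B , B-infinite , ⊆⇒≤fe B⊆A , sparse⇒≰fe B-sparse x∈A y∈A x<y (m≤m+n y x)
  where open SparseSubset A-infinite y
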